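{- Let $m>3$ be odd and let $x_j$ be a point of an extreme cycle for the digit set $\{0,m\}$. Then $x_j\equiv 0\pmod 4$ or $x_j\equiv -m\pmod 4$.
   Context: For odd $m$, a finite set $\{x_0,\dots,x_{r-1}\}\subset\mathbb{R}$ is an extreme cycle for the digits $\{0,m\}$ if there exist $l_0,\dots,l_{r-1}\in\{0,m\}$ with $x_{k+1}=(x_k+l_k)/4$ for $0\le k\le r-2$, $x_0=(x_{r-1}+l_{r-1})/4$, and $\left|\frac{1+e^{2\pi i\cdot 2x_k}}{2}\right|=1$ for all $k$. (Extreme cycle points are integers.)
   Formalization: The points of the extreme cycle are taken in the rationals rather than in ℝ. -}

module Defs where

open import Data.Nat using (ℕ; suc)
open import Data.Nat.DivMod using (_%_)
open import Data.Fin using (Fin; toℕ)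
open import Data.Integer using (ℤ; +_)
open import Data.Rational using (ℚ; _/_; _+_; _*_)
open import Data.Product using (∃)
open import Data.Sum using (_⊎_)
open import Relation.Binary.PropositionalEquality using (_≡_)

ιℤ : ℤ → ℚ
ιℤ z = z / 1

-- Extremality condition |(1 + e^{2πi·2x})/2| = 1.
-- Since |1 + e^{iθ}| = 2 iff e^{iθ} = 1 iff θ ∈ 2πℤ, with θ = 2π·2x
-- this says exactly that 2x is an integer.
ExtremePt : ℚ → Set
ExtremePt x = ∃ λ (z : ℤ) → (+ 2 / 1) * x ≡ ιℤ z

record ExtremeCycle (m n : ℕ) : Set where
  field
    x       : Fin (suc n) → ℚ
    l       : Fin (suc n) → ℕ
    digit   : ∀ k → l k ≡ 0 ⊎ l k ≡ m
    step    : ∀ (k k′ : Fin (suc n)) → toℕ k′ ≡ suc (toℕ k) % suc n →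
              x k′ ≡ (x k + ιℤ (+ l k)) * (+ 1 / 4)
    extreme : ∀ k → ExtremePt (x k)

-- Stepping backwards through the cycle gives x_k = 4 x_{k+1} − l_k.  As 2 x_{j+2} is an
-- integer, x_{j+1} = 2 (2 x_{j+2}) − l_{j+1} is an integer w, so x_j = 4 w − l_j with
-- l_j ∈ {0, m}.
module Submission where

open import Defs
open import Data.Nat using (ℕ; suc; _<_; _%_)
open import Data.Nat.DivMod using (m%n<n)
open import Data.Nat.Divisibility using (1∣_)
open import Data.Fin using (Fin; toℕ; fromℕ<)
open import Data.Fin.Properties using (toℕ-fromℕ<)
open import Data.Integer using (ℤ; +_; _+_)
open import Data.Integer.Properties using (+-identityʳ)
import Data.Integer as ℤ
open import Data.Integer.Divisibility using (_∣_; *-monoʳ-∣)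
open import Data.Integer.Tactic.RingSolver using (solve-∀)
open import Data.Rational using (ℚ; _/_; toℚᵘ)
import Data.Rational as ℚ
open import Data.Rational.Properties using (*-assoc; toℚᵘ-injective; toℚᵘ-fromℚᵘ; toℚᵘ-homo-+; toℚᵘ-homo-*; toℚᵘ-homo‿-)
open import Data.Rational.Solver using (module +-*-Solver)
open import Data.Rational.Unnormalised using (mkℚᵘ; _≃_; *≡*)
import Data.Rational.Unnormalised as ℚᵘ
open import Data.Rational.Unnormalised.Properties using (+-cong; *-cong; -‿cong; module ≃-Reasoning)
open import Data.Product using (∃; _×_; _,_; proj₁; proj₂)
open import Data.Sum using (_⊎_; inj₁; inj₂)
open import Relation.Binary.PropositionalEquality using (_≡_; refl; sym; trans; cong; subst; module ≡-Reasoning)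

toℚᵘ-ιℤ : ∀ z → toℚᵘ (ιℤ z) ≃ mkℚᵘ z 0
toℚᵘ-ιℤ z = toℚᵘ-fromℚᵘ (mkℚᵘ z 0)

ιℤ-homo-+ : ∀ a b → ιℤ (a + b) ≡ ιℤ a ℚ.+ ιℤ b
ιℤ-homo-+ a b = toℚᵘ-injective (begin
  toℚᵘ (ιℤ (a + b))             ≈⟨ toℚᵘ-ιℤ (a + b) ⟩
  mkℚᵘ (a + b) 0                ≈⟨ *≡* (a+b≡a*1+b*1 a b) ⟩
  mkℚᵘ a 0 ℚᵘ.+ mkℚᵘ b 0        ≈⟨ +-cong (toℚᵘ-ιℤ a) (toℚᵘ-ιℤ b) ⟨
  toℚᵘ (ιℤ a) ℚᵘ.+ toℚᵘ (ιℤ b)  ≈⟨ toℚᵘ-homo-+ (ιℤ a) (ιℤ b) ⟨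
  toℚᵘ (ιℤ a ℚ.+ ιℤ b)          ∎)
  where
  open ≃-Reasoning
  a+b≡a*1+b*1 : ∀ a b → (a + b) ℤ.* + 1 ≡ (a ℤ.* + 1 + b ℤ.* + 1) ℤ.* + 1
  a+b≡a*1+b*1 = solve-∀

ιℤ-homo-* : ∀ a b → ιℤ (a ℤ.* b) ≡ ιℤ a ℚ.* ιℤ b
ιℤ-homo-* a b = toℚᵘ-injective (begin
  toℚᵘ (ιℤ (a ℤ.* b))           ≈⟨ toℚᵘ-ιℤ (a ℤ.* b) ⟩
  mkℚᵘ a 0 ℚᵘ.* mkℚᵘ b 0        ≈⟨ *-cong (toℚᵘ-ιℤ a) (toℚᵘ-ιℤ b) ⟨
  toℚᵘ (ιℤ a) ℚᵘ.* toℚᵘ (ιℤ b)  ≈⟨ toℚᵘ-homo-* (ιℤ a) (ιℤ b) ⟨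
  toℚᵘ (ιℤ a ℚ.* ιℤ b)          ∎)
  where open ≃-Reasoning

ιℤ-homo‿- : ∀ a → ιℤ (ℤ.- a) ≡ ℚ.- ιℤ a
ιℤ-homo‿- a = toℚᵘ-injective (begin
  toℚᵘ (ιℤ (ℤ.- a))  ≈⟨ toℚᵘ-ιℤ (ℤ.- a) ⟩
  ℚᵘ.- mkℚᵘ a 0      ≈⟨ -‿cong (toℚᵘ-ιℤ a) ⟨
  ℚᵘ.- toℚᵘ (ιℤ a)   ≈⟨ toℚᵘ-homo‿- (ιℤ a) ⟨
  toℚᵘ (ℚ.- ιℤ a)    ∎)
  where open ≃-Reasoning

ιℤ-homo-- : ∀ a b → ιℤ (a ℤ.- b) ≡ ιℤ a ℚ.- ιℤ b
ιℤ-homo-- a b = trans (ιℤ-homo-+ a (ℤ.- b)) (cong (ιℤ a ℚ.+_) (ιℤ-homo‿- b))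

¼ : ℚ
¼ = + 1 / 4

x≡4*[[x+t]*¼]-t : ∀ x t → x ≡ ιℤ (+ 4) ℚ.* ((x ℚ.+ t) ℚ.* ¼) ℚ.- t
x≡4*[[x+t]*¼]-t = solve 2 (λ x t → x := con (ιℤ (+ 4)) :* ((x :+ t) :* con ¼) :- t) refl
  where open +-*-Solver

integral-predecessor : ∀ {x y} c t → ιℤ (+ 4) ℚ.* y ≡ ιℤ c → y ≡ (x ℚ.+ ιℤ t) ℚ.* ¼ →
                       x ≡ ιℤ (c ℤ.- t)
integral-predecessor {x} {y} c t 4y≡c y≡[x+t]/4 = begin
  x                                          ≡⟨ x≡4*[[x+t]*¼]-t x (ιℤ t) ⟩
  ιℤ (+ 4) ℚ.* ((x ℚ.+ ιℤ t) ℚ.* ¼) ℚ.- ιℤ t  ≡⟨ cong (λ y → ιℤ (+ 4) ℚ.* y ℚ.- ιℤ t) y≡[x+t]/4 ⟨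
  ιℤ (+ 4) ℚ.* y ℚ.- ιℤ t                    ≡⟨ cong (ℚ._- ιℤ t) 4y≡c ⟩
  ιℤ c ℚ.- ιℤ t                              ≡⟨ ιℤ-homo-- c t ⟨
  ιℤ (c ℤ.- t)                               ∎
  where open ≡-Reasoning

4*-of-half-integral : ∀ {y} z → ιℤ (+ 2) ℚ.* y ≡ ιℤ z → ιℤ (+ 4) ℚ.* y ≡ ιℤ (+ 2 ℤ.* z)
4*-of-half-integral {y} z 2y≡z = begin
  ιℤ (+ 4) ℚ.* y                  ≡⟨ *-assoc (ιℤ (+ 2)) (ιℤ (+ 2)) y ⟩
  ιℤ (+ 2) ℚ.* (ιℤ (+ 2) ℚ.* y)   ≡⟨ cong (ιℤ (+ 2) ℚ.*_) 2y≡z ⟩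
  ιℤ (+ 2) ℚ.* ιℤ z               ≡⟨ ιℤ-homo-* (+ 2) z ⟨
  ιℤ (+ 2 ℤ.* z)                  ∎
  where open ≡-Reasoning

module _ {m n} (C : ExtremeCycle m n) where
  open ExtremeCycle C

  next : Fin (suc n) → Fin (suc n)
  next k = fromℕ< (m%n<n (suc (toℕ k)) (suc n))

  x-next : ∀ k → x (next k) ≡ (x k ℚ.+ ιℤ (+ l k)) ℚ.* ¼
  x-next k = step k (next k) (toℕ-fromℕ< _)

  x≡4w-l : ∀ k → ∃ λ w → x k ≡ ιℤ (+ 4 ℤ.* w ℤ.- + l k)
  x≡4w-l k with extreme (next (next k))
  ... | z , 2x≡z = w , integral-predecessor (+ 4 ℤ.* w) (+ l k) 4x[next]≡4w (x-next k)
    where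
    w : ℤ
    w = + 2 ℤ.* z ℤ.- + l (next k)
    x[next]≡w : x (next k) ≡ ιℤ w
    x[next]≡w = integral-predecessor (+ 2 ℤ.* z) (+ l (next k))
                  (4*-of-half-integral {x (next (next k))} z 2x≡z) (x-next (next k))
    4x[next]≡4w : ιℤ (+ 4) ℚ.* x (next k) ≡ ιℤ (+ 4 ℤ.* w)
    4x[next]≡4w = trans (cong (ιℤ (+ 4) ℚ.*_) x[next]≡w) (sym (ιℤ-homo-* (+ 4) w))

4∣4* : ∀ w → + 4 ∣ + 4 ℤ.* w
4∣4* w = *-monoʳ-∣ (+ 4) {+ 1} {w} (1∣ ℤ.∣ w ∣)

4∣4w-l⊎4∣4w-l+m : ∀ w {l m} → l ≡ 0 ⊎ l ≡ m →
                   + 4 ∣ (+ 4 ℤ.* w ℤ.- + l) ⊎ + 4 ∣ (+ 4 ℤ.* w ℤ.- + l + + m)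
4∣4w-l⊎4∣4w-l+m w (inj₁ refl) = inj₁ (subst (+ 4 ∣_) (sym (+-identityʳ (+ 4 ℤ.* w))) (4∣4* w))
4∣4w-l⊎4∣4w-l+m w {m = m} (inj₂ refl) =
  inj₂ (subst (+ 4 ∣_) (sym (i-j+j≡i (+ 4 ℤ.* w) (+ m))) (4∣4* w))
  where
  i-j+j≡i : ∀ i j → i ℤ.- j + j ≡ i
  i-j+j≡i = solve-∀

lemma2p3 : ∀ (m : ℕ) → 3 < m → m % 2 ≡ 1 →
    ∀ (n : ℕ) (C : ExtremeCycle m n) (j : Fin (suc n)) →
    ∃ λ (z : ℤ) → ExtremeCycle.x C j ≡ ιℤ z × ((+ 4 ∣ z) ⊎ (+ 4 ∣ (z + + m)))
lemma2p3 m _ _ n C j = + 4 ℤ.* w ℤ.- + l j , xj≡4w-l , 4∣4w-l⊎4∣4w-l+m w (digit j)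
  where
  open ExtremeCycle C
  w : ℤ
  w = proj₁ (x≡4w-l C j)
  xj≡4w-l : x j ≡ ιℤ (+ 4 ℤ.* w ℤ.- + l j)
  xj≡4w-l = proj₂ (x≡4w-l C j)
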